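{- For every even integer $m\ge 2$, the digraph $\vec{C}_m\wr \overline{K}_2$ has a $\vec{C}_m$-factorization, and it also has a $\vec{C}_{2m}$-factorization.
   Context: $\vec{C}_k$ denotes the directed cycle of length $k$ and $\overline{K}_2$ the empty graph on 2 vertices. For digraphs $G$ and $H$, the wreath product $G\wr H$ is obtained by replacing each vertex $a$ of $G$ by a copy $H_a$ of $H$ and each arc $(a,b)$ of $G$ by arcs from every vertex of $H_a$ to every vertex of $H_b$. A $\vec{C}_k$-factorization of a digraph is a partition of its arc set into spanning subdigraphs each of which is a vertex-disjoint union of directed $k$-cycles. -}

module Defs where

open import Data.Nat using (ℕ; suc; _∸_)
open import Data.Fin using (Fin; toℕ)
open import Data.Product using (Σ; ∃; _×_; _,_)
open import Data.Sum using (_⊎_)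
open import Data.Empty using (⊥)
open import Relation.Binary.PropositionalEquality using (_≡_)

record Digraph : Set₁ where
  field
    V   : Set
    Arc : V → V → Set
open Digraph public

CycArc : (k : ℕ) → Fin k → Fin k → Set
CycArc k i j = (toℕ j ≡ suc (toℕ i)) ⊎ ((toℕ i ≡ k ∸ 1) × (toℕ j ≡ 0))

DiCycle : ℕ → Digraph
DiCycle k = record { V = Fin k ; Arc = CycArc k }

EmptyK2 : Digraph
EmptyK2 = record { V = Fin 2 ; Arc = λ _ _ → ⊥ }

-- Wreath (lexicographic) product G ≀ H: copy H_a of H for each vertex a of G,
-- and all arcs from H_a to H_b whenever (a,b) is an arc of G.
_≀_ : Digraph → Digraph → Digraph
G ≀ H = record
  { V   = V G × V H
  ; Arc = λ { (a , x) (b , y) → Arc G a b ⊎ ((a ≡ b) × Arc H x y) } }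

-- A spanning subdigraph of D which is a vertex-disjoint union of directed
-- k-cycles: cycles indexed by Fin r, cycle s having vertex sequence cyc s,
-- every vertex of D lying on exactly one cycle at exactly one position
-- (so cycles are vertex-disjoint, each cycle has k distinct vertices,
-- and the union is spanning).
record CycleFactor (D : Digraph) (k : ℕ) : Set where
  field
    r      : ℕ
    cyc    : Fin r → Fin k → V D
    cover  : ∀ v → Σ (Fin r) λ s → Σ (Fin k) λ i → cyc s i ≡ v
    unique : ∀ v (s s′ : Fin r) (i i′ : Fin k) →
             cyc s i ≡ v → cyc s′ i′ ≡ v → (s ≡ s′) × (i ≡ i′)
open CycleFactor public

FArc : ∀ {D k} → CycleFactor D k → V D → V D → Set
FArc {D} {k} F u v =
  Σ (Fin (r F)) λ s → Σ (Fin k) λ i → Σ (Fin k) λ j →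
    CycArc k i j × (cyc F s i ≡ u) × (cyc F s j ≡ v)

record Factorization (D : Digraph) (k : ℕ) : Set₁ where
  field
    t        : ℕ
    factor   : Fin t → CycleFactor D k
    sub      : ∀ f u v → FArc (factor f) u v → Arc D u v
    covered  : ∀ u v → Arc D u v → ∃ λ f → FArc (factor f) u v
    disjoint : ∀ u v (f g : Fin t) →
               FArc (factor f) u v → FArc (factor g) u v → f ≡ g

module Submission where

-- Write the vertices of C⃗_m ≀ K̄₂ as (a , x) with a ∈ ℤ_m and x ∈ ℤ₂. A voltage
-- c : ℤ_m → ℤ₂ gives the permutation (a , x) ↦ (a + 1 , x + c a) of the vertices, whose
-- graph lies in C⃗_m ≀ K̄₂, and the graphs for c and c + 1 partition its arcs. When m is
-- even, adding the parity of a to x is an automorphism exchanging c and c + 1, so one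
-- voltage whose permutation has all cycles of length k yields a C⃗_k-factorization.
-- For k = m take c = 0 (the two layers); for k = 2m take c = 1 only on the arc
-- m - 1 → 0 (a single cycle running through layer 0 and then layer 1).

open import Defs
open import Data.Nat using (ℕ; zero; suc; _+_; _*_; _∸_; _≤_; _<_; _<?_)
open import Data.Nat.Properties
  using (≤-antisym; <-irrefl; ≤-pred; <⇒≤pred; ≰⇒>; +-suc; +-identityʳ; *-zeroʳ; *-identityʳ)
open import Data.Nat.Divisibility using (_∣_; divides)
open import Data.Fin using (Fin; toℕ; fromℕ<; combine; remQuot)
open import Data.Fin.Patterns using (0F; 1F)
open import Data.Fin.Properties
  using (toℕ-injective; toℕ-fromℕ<; toℕ<n; toℕ-combine; remQuot-combine; combine-remQuot)
open import Data.Product using (∃; _×_; _,_; proj₁; proj₂; uncurry; swap)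
open import Data.Product.Properties using (,-injectiveˡ; ,-injectiveʳ)
open import Data.Sum using (_⊎_; inj₁; inj₂)
open import Data.Empty using (⊥-elim)
open import Function using (_∘_; const)
open import Relation.Nullary using (¬_; yes; no)
open import Relation.Binary.PropositionalEquality

csucc : ∀ {k} → Fin k → Fin k
csucc {suc n} i with suc (toℕ i) <? suc n
... | yes p = fromℕ< p
... | no _ = 0F

¬suc<⇒≡pred : ∀ {n} {i : Fin (suc n)} → ¬ suc (toℕ i) < suc n → toℕ i ≡ n
¬suc<⇒≡pred {i = i} p = ≤-antisym (<⇒≤pred (toℕ<n i)) (≤-pred (<⇒≤pred (≰⇒> p)))

cycArc-csucc : ∀ {k} (i : Fin k) → CycArc k i (csucc i)
cycArc-csucc {suc n} i with suc (toℕ i) <? suc n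
... | yes p = inj₁ (toℕ-fromℕ< p)
... | no p = inj₂ (¬suc<⇒≡pred p , refl)

last-has-no-successor : ∀ {n} {i j : Fin (suc n)} → toℕ j ≡ suc (toℕ i) → ¬ toℕ i ≡ n
last-has-no-successor {n} {i} {j} e e′ =
  <-irrefl refl (subst (_< suc n) (trans e (cong suc e′)) (toℕ<n j))

cycArc-functional : ∀ {k} {i j j′ : Fin k} → CycArc k i j → CycArc k i j′ → j ≡ j′
cycArc-functional (inj₁ e) (inj₁ e′) = toℕ-injective (trans e (sym e′))
cycArc-functional (inj₂ (_ , e)) (inj₂ (_ , e′)) = toℕ-injective (trans e (sym e′))
cycArc-functional {suc n} (inj₁ e) (inj₂ (e′ , _)) = ⊥-elim (last-has-no-successor e e′)
cycArc-functional {suc n} (inj₂ (e , _)) (inj₁ e′) = ⊥-elim (last-has-no-successor e′ e)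

cycArc⇒≡csucc : ∀ {k} {i j : Fin k} → CycArc k i j → j ≡ csucc i
cycArc⇒≡csucc {i = i} arc = cycArc-functional arc (cycArc-csucc i)

not : Fin 2 → Fin 2
not 0F = 1F
not 1F = 0F

_xor_ : Fin 2 → Fin 2 → Fin 2
0F xor y = y
1F xor y = not y

not-involutive : ∀ x → not (not x) ≡ x
not-involutive 0F = refl
not-involutive 1F = refl

x≢not-x : ∀ x → ¬ x ≡ not x
x≢not-x 0F ()
x≢not-x 1F ()

≡⊎≡not : ∀ x y → x ≡ y ⊎ x ≡ not y
≡⊎≡not 0F 0F = inj₁ refl
≡⊎≡not 0F 1F = inj₂ refl
≡⊎≡not 1F 0F = inj₂ refl
≡⊎≡not 1F 1F = inj₁ refl

xor-identityʳ : ∀ x → x xor 0F ≡ x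
xor-identityʳ 0F = refl
xor-identityʳ 1F = refl

xor-cancelʳ : ∀ x y → (x xor y) xor y ≡ x
xor-cancelʳ 0F 0F = refl
xor-cancelʳ 0F 1F = refl
xor-cancelʳ 1F 0F = refl
xor-cancelʳ 1F 1F = refl

xor-notʳ : ∀ x y → x xor not y ≡ not (x xor y)
xor-notʳ 0F y = refl
xor-notʳ 1F 0F = refl
xor-notʳ 1F 1F = refl

xor-not-exchange : ∀ x y z → (x xor y) xor not z ≡ (x xor z) xor not y
xor-not-exchange 0F 0F 0F = refl
xor-not-exchange 0F 0F 1F = refl
xor-not-exchange 0F 1F 0F = refl
xor-not-exchange 0F 1F 1F = refl
xor-not-exchange 1F 0F 0F = refl
xor-not-exchange 1F 0F 1F = refl
xor-not-exchange 1F 1F 0F = refl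
xor-not-exchange 1F 1F 1F = refl

parity : ℕ → Fin 2
parity zero = 0F
parity (suc n) = not (parity n)

parity-even : ∀ {m} → 2 ∣ m → parity m ≡ 0F
parity-even (divides q refl) = parity-double q
  where
  parity-double : ∀ q → parity (q * 2) ≡ 0F
  parity-double zero = refl
  parity-double (suc q) = trans (not-involutive (parity (q * 2))) (parity-double q)

parity-alternates : ∀ {k} → parity k ≡ 0F → {a b : Fin k} → CycArc k a b →
                    parity (toℕ b) ≡ not (parity (toℕ a))
parity-alternates _ (inj₁ e) rewrite e = refl
parity-alternates {suc n} even (inj₂ (ea , eb)) rewrite ea | eb = sym even

-- σ is a permutation all of whose cycles have length k, the s-th cycle being
-- vertexAt s 0 ↦ vertexAt s 1 ↦ ⋯ ↦ vertexAt s (k - 1) ↦ vertexAt s 0.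
record UniformCycles {V : Set} (σ : V → V) (k : ℕ) : Set where
  field
    count             : ℕ
    vertexAt          : Fin count → Fin k → V
    position          : V → Fin count × Fin k
    vertexAt-position : ∀ v → uncurry vertexAt (position v) ≡ v
    position-vertexAt : ∀ s i → position (vertexAt s i) ≡ (s , i)
    vertexAt-csucc    : ∀ s i → vertexAt s (csucc i) ≡ σ (vertexAt s i)
open UniformCycles

module _ {D : Digraph} {σ : V D → V D} {k : ℕ} (C : UniformCycles σ k) where

  cycleFactor : CycleFactor D k
  cycleFactor = record
    { r      = count C
    ; cyc    = vertexAt C
    ; cover  = λ v → proj₁ (position C v) , proj₂ (position C v) , vertexAt-position C v
    ; unique = λ v s s′ i i′ e e′ → let same = position-agrees (trans e (sym e′)) in
                 ,-injectiveˡ same , ,-injectiveʳ same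
    }
    where
    position-agrees : ∀ {s s′ i i′} → vertexAt C s i ≡ vertexAt C s′ i′ → (s , i) ≡ (s′ , i′)
    position-agrees {s} {s′} {i} {i′} e = begin
      (s , i)                         ≡⟨ position-vertexAt C s i ⟨
      position C (vertexAt C s i)     ≡⟨ cong (position C) e ⟩
      position C (vertexAt C s′ i′)   ≡⟨ position-vertexAt C s′ i′ ⟩
      (s′ , i′)                       ∎
      where open ≡-Reasoning

  FArc-cycleFactor⁻ : ∀ {u v} → FArc cycleFactor u v → v ≡ σ u
  FArc-cycleFactor⁻ (s , i , j , arc , refl , refl) =
    trans (cong (vertexAt C s) (cycArc⇒≡csucc arc)) (vertexAt-csucc C s i)

  FArc-cycleFactor⁺ : ∀ {u v} → v ≡ σ u → FArc cycleFactor u v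
  FArc-cycleFactor⁺ {u} refl =
    s , i , csucc i , cycArc-csucc i , vertexAt-position C u ,
    trans (vertexAt-csucc C s i) (cong σ (vertexAt-position C u))
    where
    s : Fin (count C)
    s = proj₁ (position C u)
    i : Fin k
    i = proj₂ (position C u)

conjugate : ∀ {V : Set} {σ σ′ : V → V} {k} (τ : V → V) →
            (∀ v → τ (τ v) ≡ v) → (∀ v → τ (σ v) ≡ σ′ (τ v)) →
            UniformCycles σ k → UniformCycles σ′ k
conjugate τ τ-involutive τ-intertwines C = record
  { count             = count C
  ; vertexAt          = λ s i → τ (vertexAt C s i)
  ; position          = position C ∘ τ
  ; vertexAt-position = λ v → trans (cong τ (vertexAt-position C (τ v))) (τ-involutive v)
  ; position-vertexAt = λ s i → trans (cong (position C) (τ-involutive _)) (position-vertexAt C s i)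
  ; vertexAt-csucc    = λ s i → trans (cong τ (vertexAt-csucc C s i)) (τ-intertwines _)
  }

module _ {m : ℕ} where

  private
    D : Digraph
    D = DiCycle m ≀ EmptyK2

  shift : (Fin m → Fin 2) → Fin m × Fin 2 → Fin m × Fin 2
  shift c (a , x) = csucc a , x xor c a

  arc-shift : ∀ c u → Arc D u (shift c u)
  arc-shift c (a , x) = inj₁ (cycArc-csucc a)

  arc⇒shift : ∀ c {u v} → Arc D u v → v ≡ shift c u ⊎ v ≡ shift (not ∘ c) u
  arc⇒shift c {a , x} {b , y} (inj₁ arc) with ≡⊎≡not y (x xor c a)
  ... | inj₁ e = inj₁ (cong₂ _,_ (cycArc⇒≡csucc arc) e)
  ... | inj₂ e = inj₂ (cong₂ _,_ (cycArc⇒≡csucc arc) (trans e (sym (xor-notʳ x (c a)))))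

  shift-not-distinct : ∀ c u → ¬ shift c u ≡ shift (not ∘ c) u
  shift-not-distinct c (a , x) e =
    x≢not-x (x xor c a) (trans (,-injectiveʳ e) (xor-notʳ x (c a)))

  factorization : ∀ {c k} → UniformCycles (shift c) k → UniformCycles (shift (not ∘ c)) k →
                  Factorization D k
  factorization {c} {k} C C′ = record
    { t        = 2
    ; factor   = factor
    ; sub      = sub
    ; covered  = covered
    ; disjoint = disjoint
    }
    where
    factor : Fin 2 → CycleFactor D k
    factor 0F = cycleFactor C
    factor 1F = cycleFactor C′

    voltage : Fin 2 → Fin m → Fin 2
    voltage 0F = c
    voltage 1F = not ∘ c

    follows : ∀ f {u v} → FArc (factor f) u v → v ≡ shift (voltage f) u
    follows 0F = FArc-cycleFactor⁻ {D = D} C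
    follows 1F = FArc-cycleFactor⁻ {D = D} C′

    sub : ∀ f u v → FArc (factor f) u v → Arc D u v
    sub f u v a = subst (Arc D u) (sym (follows f a)) (arc-shift (voltage f) u)

    covered : ∀ u v → Arc D u v → ∃ λ f → FArc (factor f) u v
    covered u v a with arc⇒shift c {u} {v} a
    ... | inj₁ e = 0F , FArc-cycleFactor⁺ {D = D} C e
    ... | inj₂ e = 1F , FArc-cycleFactor⁺ {D = D} C′ e

    disjoint : ∀ u v f g → FArc (factor f) u v → FArc (factor g) u v → f ≡ g
    disjoint u v 0F 0F _ _ = refl
    disjoint u v 1F 1F _ _ = refl
    disjoint u v 0F 1F a a′ = ⊥-elim (shift-not-distinct c u (trans (sym (follows 0F a)) (follows 1F a′)))
    disjoint u v 1F 0F a a′ = ⊥-elim (shift-not-distinct c u (trans (sym (follows 0F a′)) (follows 1F a)))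

  complement : ∀ {c k} → 2 ∣ m → UniformCycles (shift c) k → UniformCycles (shift (not ∘ c)) k
  complement {c} 2∣m = conjugate recolour recolour-involutive recolour-shift
    where
    recolour : Fin m × Fin 2 → Fin m × Fin 2
    recolour (a , x) = a , x xor parity (toℕ a)

    recolour-involutive : ∀ v → recolour (recolour v) ≡ v
    recolour-involutive (a , x) = cong (a ,_) (xor-cancelʳ x (parity (toℕ a)))

    recolour-shift : ∀ v → recolour (shift c v) ≡ shift (not ∘ c) (recolour v)
    recolour-shift (a , x) = cong (csucc a ,_) (begin
      (x xor c a) xor parity (toℕ (csucc a))   ≡⟨ cong ((x xor c a) xor_) alternates ⟩
      (x xor c a) xor not (parity (toℕ a))     ≡⟨ xor-not-exchange x (c a) (parity (toℕ a)) ⟩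
      (x xor parity (toℕ a)) xor not (c a)     ∎)
      where
      open ≡-Reasoning
      alternates : parity (toℕ (csucc a)) ≡ not (parity (toℕ a))
      alternates = parity-alternates (parity-even 2∣m) (cycArc-csucc a)

  factorization-even : ∀ {c k} → 2 ∣ m → UniformCycles (shift c) k → Factorization D k
  factorization-even 2∣m C = factorization C (complement 2∣m C)

layers : ∀ {m} → UniformCycles (shift {m} (const 0F)) m
layers = record
  { count             = 2
  ; vertexAt          = λ x a → a , x
  ; position          = swap
  ; vertexAt-position = λ _ → refl
  ; position-vertexAt = λ _ _ → refl
  ; vertexAt-csucc    = λ x a → cong (csucc a ,_) (sym (xor-identityʳ x))
  }

carry : ∀ {k} → Fin k → Fin 2
carry {suc n} i with suc (toℕ i) <? suc n
... | yes _ = 0F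
... | no _ = 1F

toℕ-combine-0F : ∀ {m} (a : Fin m) → toℕ (combine {2} 0F a) ≡ toℕ a
toℕ-combine-0F {m} a = trans (toℕ-combine {2} 0F a) (cong (_+ toℕ a) (*-zeroʳ m))

toℕ-combine-1F : ∀ {m} (a : Fin m) → toℕ (combine {2} 1F a) ≡ m + toℕ a
toℕ-combine-1F {m} a = trans (toℕ-combine {2} 1F a) (cong (_+ toℕ a) (*-identityʳ m))

cycArc-combine : ∀ {n} (x : Fin 2) (a : Fin (suc n)) →
                 CycArc (2 * suc n) (combine x a) (combine (x xor carry a) (csucc a))
cycArc-combine {n} x a with suc (toℕ a) <? suc n
cycArc-combine {n} x a | yes p rewrite xor-identityʳ x = inj₁ (begin
  toℕ (combine x (fromℕ< p))      ≡⟨ toℕ-combine x (fromℕ< p) ⟩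
  suc n * toℕ x + toℕ (fromℕ< p)  ≡⟨ cong (suc n * toℕ x +_) (toℕ-fromℕ< p) ⟩
  suc n * toℕ x + suc (toℕ a)     ≡⟨ +-suc (suc n * toℕ x) (toℕ a) ⟩
  suc (suc n * toℕ x + toℕ a)     ≡⟨ cong suc (toℕ-combine x a) ⟨
  suc (toℕ (combine x a))         ∎)
  where open ≡-Reasoning
cycArc-combine {n} 0F a | no p = inj₁ (begin
  toℕ (combine {2} 1F 0F)         ≡⟨ toℕ-combine-1F 0F ⟩
  suc n + 0                       ≡⟨ +-identityʳ (suc n) ⟩
  suc n                           ≡⟨ cong suc (¬suc<⇒≡pred p) ⟨
  suc (toℕ a)                     ≡⟨ cong suc (toℕ-combine-0F a) ⟨
  suc (toℕ (combine {2} 0F a))    ∎)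
  where open ≡-Reasoning
cycArc-combine {n} 1F a | no p = inj₂ ((begin
  toℕ (combine {2} 1F a)          ≡⟨ toℕ-combine-1F a ⟩
  suc n + toℕ a                   ≡⟨ cong (suc n +_) (¬suc<⇒≡pred p) ⟩
  suc (n + n)                     ≡⟨ cong (λ l → suc (n + l)) (+-identityʳ n) ⟨
  suc (n + (n + 0))               ≡⟨ +-suc n (n + 0) ⟨
  2 * suc n ∸ 1                   ∎) , refl)
  where open ≡-Reasoning

spiral : ∀ {n} → UniformCycles (shift {suc n} carry) (2 * suc n)
spiral {n} = record
  { count             = 1
  ; vertexAt          = λ _ → coordinates
  ; position          = λ (a , x) → 0F , combine x a
  ; vertexAt-position = λ (a , x) → cong swap (remQuot-combine x a)
  ; position-vertexAt = λ { 0F j → cong (0F ,_) (combine-remQuot {2} (suc n) j) }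
  ; vertexAt-csucc    = λ _ → coordinates-csucc
  }
  where
  coordinates : Fin (2 * suc n) → Fin (suc n) × Fin 2
  coordinates j = swap (remQuot {2} (suc n) j)

  coordinates-csucc : ∀ j → coordinates (csucc j) ≡ shift carry (coordinates j)
  coordinates-csucc j = begin
    coordinates (csucc j)                            ≡⟨ cong (coordinates ∘ csucc) (combine-remQuot {2} (suc n) j) ⟨
    coordinates (csucc (combine x a))                ≡⟨ cong coordinates (cycArc⇒≡csucc (cycArc-combine x a)) ⟨
    coordinates (combine (x xor carry a) (csucc a))  ≡⟨ cong swap (remQuot-combine (x xor carry a) (csucc a)) ⟩
    (csucc a , x xor carry a)                        ∎
    where
    open ≡-Reasoning
    x : Fin 2
    x = proj₁ (remQuot {2} (suc n) j)
    a : Fin (suc n)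
    a = proj₂ (remQuot {2} (suc n) j)

lemma3p3 : (m : ℕ) → 2 ≤ m → 2 ∣ m →
    Factorization (DiCycle m ≀ EmptyK2) m × Factorization (DiCycle m ≀ EmptyK2) (2 * m)
lemma3p3 (suc n) _ 2∣m = factorization-even 2∣m layers , factorization-even 2∣m spiral
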